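{- If $G$ is a simple graph of class one, i.e. $\chi'(G)=\Delta(G)$, then $\chi^{c}_i(G)=2\Delta(G)$.
   Context: An incidence of a graph $G$ is a pair $(v,e)$ where $v$ is a vertex and $e$ an edge incident with $v$. For a vertex $w$, let $I(w)$ be the set of all incidences $(u,e)$ such that $e$ is incident with $w$. Two incidences conflict if both lie in $I(w)$ for some vertex $w$. A conflict-free incidence $k$-coloring assigns colors from a $k$-element set to the incidences so that conflicting incidences get distinct colors; $\chi^{c}_i(G)$ is the least such $k$. $\chi'(G)$ denotes the chromatic index and $\Delta(G)$ the maximum degree. -}

module Defs where

open import Data.Nat using (ℕ; _+_; _⊔_; _≤_)
open import Data.Bool using (Bool; true; false; if_then_else_)
open import Data.Fin using (Fin)
open import Data.List using (List; map; foldr; allFin)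
open import Data.Nat.ListAction using (sum)
open import Data.Product using (Σ; ∃; _×_; _,_)
open import Data.Sum using (_⊎_)
open import Relation.Binary.PropositionalEquality using (_≡_; _≢_)

record SimpleGraph (n : ℕ) : Set where
  field
    Adj    : Fin n → Fin n → Bool
    sym    : ∀ u v → Adj u v ≡ Adj v u
    irrefl : ∀ v → Adj v v ≡ false

module _ {n : ℕ} (G : SimpleGraph n) where
  open SimpleGraph G

  degree : Fin n → ℕ
  degree v = sum (map (λ u → if Adj v u then 1 else 0) (allFin n))

  Δ : ℕ
  Δ = foldr _⊔_ 0 (map degree (allFin n))

  record EdgeColouring (k : ℕ) : Set where
    field
      col      : (u v : Fin n) → Adj u v ≡ true → Fin k
      col-sym  : ∀ u v (p : Adj u v ≡ true) (q : Adj v u ≡ true) → col u v p ≡ col v u q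
      proper   : ∀ u v w (p : Adj u v ≡ true) (q : Adj u w ≡ true) →
                 v ≢ w → col u v p ≢ col u w q

  IsChromaticIndex : ℕ → Set
  IsChromaticIndex k = EdgeColouring k × (∀ j → EdgeColouring j → k ≤ j)

  -- An incidence (v , e) with e = {v , w} is identified with the ordered
  -- pair (v , w) of adjacent vertices.
  Incidence : Set
  Incidence = Σ (Fin n × Fin n) (λ { (v , w) → Adj v w ≡ true })

  InI : Fin n → Incidence → Set
  InI x ((u , v) , _) = u ≡ x ⊎ v ≡ x

  Conflict : Incidence → Incidence → Set
  Conflict a b = ∃ λ x → InI x a × InI x b

  DistinctInc : Incidence → Incidence → Set
  DistinctInc ((u , v) , _) ((u' , v') , _) = (u , v) ≢ (u' , v')

  record ConflictFreeIncColouring (k : ℕ) : Set where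
    field
      col        : Incidence → Fin k
      conflictFree : ∀ a b → DistinctInc a b → Conflict a b → col a ≢ col b

  IsCFIncChromatic : ℕ → Set
  IsCFIncChromatic k = ConflictFreeIncColouring k × (∀ j → ConflictFreeIncColouring j → k ≤ j)

-- Lower bound, for every graph: the 2·deg(x) incidences (x, xu) and (u, xu) at a vertex x all
-- lie in I(x), so they pairwise conflict and need distinct colours.
-- Upper bound: colour the incidence (v, vw) by the pair (colour of vw, whether v < w) for a
-- proper edge colouring. Two conflicting incidences share a vertex, so equal edge colours force
-- them onto the same edge; being distinct, they are then its two opposite incidences, which the
-- orientation bit separates. This gives 2χ′ colours, which meets the lower bound when χ′ = Δ.
module Submission where

open import Defs
open import Data.Bool using (Bool; true; false; if_then_else_)
open import Data.Fin using (Fin; zero; suc; combine; _≟_)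
open import Data.Fin.Properties using (combine-injective; injective⇒≤; <-cmp; <-asym)
open import Data.List using (List; []; _∷_; _++_; length; map; allFin; lookup)
open import Data.List.Properties using (length-++; length-map; foldr-preservesᵇ)
open import Data.List.Relation.Unary.All as All using (All; []; _∷_)
open import Data.List.Membership.Propositional.Properties using (∈-lookup)
open import Data.List.Relation.Unary.All.Properties using (++⁺; map⁺)
open import Data.List.Relation.Unary.AllPairs as AllPairs using (AllPairs; []; _∷_)
import Data.List.Relation.Unary.AllPairs.Properties as AllPairs
open import Data.Nat using (ℕ; _*_; _+_; _⊔_; _≤_; z≤n)
open import Data.Nat.ListAction using (sum)
open import Data.Nat.Properties using (*-distribˡ-⊔; *-distribˡ-+; ⊔-lub)
open import Data.Product using (_×_; _,_; proj₁; proj₂; swap)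
open import Data.Sum using (_⊎_; inj₁; inj₂)
open import Relation.Binary.Definitions using (tri<; tri≈; tri>)
open import Relation.Binary.PropositionalEquality
open import Relation.Nullary using (yes; no; contradiction)

lookup-injective : ∀ {k} {xs : List (Fin k)} → AllPairs _≢_ xs →
                   ∀ i j → lookup xs i ≡ lookup xs j → i ≡ j
lookup-injective (_ ∷ _)      zero    zero    _  = refl
lookup-injective (x≢ ∷ _)     zero    (suc j) eq = contradiction eq (All.lookup x≢ (∈-lookup j))
lookup-injective (x≢ ∷ _)     (suc i) zero    eq = contradiction (sym eq) (All.lookup x≢ (∈-lookup i))
lookup-injective (_ ∷ xs≢)    (suc i) (suc j) eq = cong suc (lookup-injective xs≢ i j eq)

distinct⇒length≤ : ∀ {k} {xs : List (Fin k)} → AllPairs _≢_ xs → length xs ≤ k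
distinct⇒length≤ xs≢ = injective⇒≤ (λ {i} {j} → lookup-injective xs≢ i j)

module _ {n : ℕ} (G : SimpleGraph n) where
  open SimpleGraph G using (Adj; irrefl)

  Adj-sym : ∀ {u v} → Adj u v ≡ true → Adj v u ≡ true
  Adj-sym {u} {v} p = trans (SimpleGraph.sym G v u) p

  Adj⇒≢ : ∀ {u v} → Adj u v ≡ true → u ≢ v
  Adj⇒≢ {u} p refl with trans (sym p) (irrefl u)
  ... | ()

  Clashing : Incidence G → Incidence G → Set
  Clashing a b = DistinctInc G a b × Conflict G a b

  clique-length≤ : ∀ {k} → ConflictFreeIncColouring G k →
                   ∀ {as} → AllPairs Clashing as → length as ≤ k
  clique-length≤ C {as} clique = subst (_≤ _) (length-map col as)
    (distinct⇒length≤ (AllPairs.map⁺ (AllPairs.map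
      (λ (d , c) → conflictFree _ _ d c) clique)))
    where open ConflictFreeIncColouring C

  -- Matching on Adj x u while remembering the equation supplies the adjacency proofs.
  edgeIncidences : (x u : Fin n) (b : Bool) → Adj x u ≡ b → List (Incidence G)
  edgeIncidences x u true  p = ((x , u) , p) ∷ ((u , x) , Adj-sym p) ∷ []
  edgeIncidences x u false _ = []

  star : Fin n → List (Fin n) → List (Incidence G)
  star x []       = []
  star x (u ∷ us) = edgeIncidences x u (Adj x u) refl ++ star x us

  module _ (x : Fin n) where

    indicator : Fin n → ℕ
    indicator u = if Adj x u then 1 else 0

    length-star : ∀ us → length (star x us) ≡ 2 * sum (map indicator us)
    length-star []       = refl
    length-star (u ∷ us) = begin
      length (edgeIncidences x u (Adj x u) refl ++ star x us)
        ≡⟨ length-++ (edgeIncidences x u (Adj x u) refl) ⟩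
      length (edgeIncidences x u (Adj x u) refl) + length (star x us)
        ≡⟨ cong₂ _+_ (length-edgeIncidences (Adj x u) refl) (length-star us) ⟩
      2 * indicator u + 2 * sum (map indicator us)
        ≡⟨ *-distribˡ-+ 2 (indicator u) _ ⟨
      2 * sum (map indicator (u ∷ us)) ∎
      where
      open ≡-Reasoning
      length-edgeIncidences : ∀ b (p : Adj x u ≡ b) →
        length (edgeIncidences x u b p) ≡ 2 * (if b then 1 else 0)
      length-edgeIncidences true  _ = refl
      length-edgeIncidences false _ = refl

    BothIncidences : (Incidence G → Set) → Fin n → Set
    BothIncidences P u = (p : Adj x u ≡ true) → P ((x , u) , p) × P ((u , x) , Adj-sym p)

    All-edgeIncidences : ∀ {P} {u} b (p : Adj x u ≡ b) → BothIncidences P u →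
                         All P (edgeIncidences x u b p)
    All-edgeIncidences true  p h = proj₁ (h p) ∷ proj₂ (h p) ∷ []
    All-edgeIncidences false _ _ = []

    All-star : ∀ {P} {us} → All (BothIncidences P) us → All P (star x us)
    All-star []                   = []
    All-star {us = u ∷ _} (h ∷ hs) = ++⁺ (All-edgeIncidences (Adj x u) refl h) (All-star hs)

    star-clique : ∀ {us} → AllPairs _≢_ us → AllPairs Clashing (star x us)
    star-clique []                      = []
    star-clique {u ∷ us} (u∉us ∷ us≢) =
      AllPairs.++⁺ (pair (Adj x u) refl) (star-clique us≢)
        (All-edgeIncidences (Adj x u) refl (λ p →
           All-star (All.map (λ u≢v q → outgoing p u≢v q , out≢in p q) u∉us)
         , All-star (All.map (λ u≢v q → in≢out p q , incoming p u≢v q) u∉us)))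
      where
      outgoing : ∀ p {v} → u ≢ v → (q : Adj x v ≡ true) →
                 Clashing ((x , u) , p) ((x , v) , q)
      outgoing p u≢v q = (λ eq → u≢v (cong proj₂ eq)) , (x , inj₁ refl , inj₁ refl)
      incoming : ∀ p {v} → u ≢ v → (q : Adj x v ≡ true) →
                 Clashing ((u , x) , Adj-sym p) ((v , x) , Adj-sym q)
      incoming p u≢v q = (λ eq → u≢v (cong proj₁ eq)) , (x , inj₂ refl , inj₂ refl)
      out≢in : ∀ p {v} (q : Adj x v ≡ true) → Clashing ((x , u) , p) ((v , x) , Adj-sym q)
      out≢in p q = (λ eq → Adj⇒≢ q (cong proj₁ eq)) , (x , inj₁ refl , inj₂ refl)
      in≢out : ∀ p {v} (q : Adj x v ≡ true) → Clashing ((u , x) , Adj-sym p) ((x , v) , q)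
      in≢out p q = (λ eq → Adj⇒≢ p (sym (cong proj₁ eq))) , (x , inj₂ refl , inj₁ refl)
      pair : ∀ b (p : Adj x u ≡ b) → AllPairs Clashing (edgeIncidences x u b p)
      pair true  p = (out≢in p p ∷ []) ∷ [] ∷ []
      pair false _ = []

  2*degree≤ : ∀ {k} → ConflictFreeIncColouring G k → ∀ x → 2 * degree G x ≤ k
  2*degree≤ C x = subst (_≤ _) (length-star x (allFin n))
    (clique-length≤ C (star-clique x (AllPairs.tabulate⁺ (λ i≢j → i≢j))))

  2*Δ≤ : ∀ {k} → ConflictFreeIncColouring G k → 2 * Δ G ≤ k
  2*Δ≤ {k} C = foldr-preservesᵇ {P = λ d → 2 * d ≤ k} (λ {d} {e} → 2*⊔≤ d e) z≤n
    (map⁺ (All.universal (2*degree≤ C) (allFin n)))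
    where
    2*⊔≤ : ∀ d e → 2 * d ≤ k → 2 * e ≤ k → 2 * (d ⊔ e) ≤ k
    2*⊔≤ d e p q = subst (_≤ _) (sym (*-distribˡ-⊔ 2 d e)) (⊔-lub p q)

orientation : ∀ {n} → Fin n → Fin n → Fin 2
orientation v w with <-cmp v w
... | tri< _ _ _ = zero
... | tri≈ _ _ _ = suc zero
... | tri> _ _ _ = suc zero

orientation-flip : ∀ {n} {v w : Fin n} → v ≢ w → orientation v w ≢ orientation w v
orientation-flip {v = v} {w} v≢w with <-cmp v w | <-cmp w v
... | tri< v<w _ _ | tri< w<v _ _ = λ _ → <-asym v<w w<v
... | tri< _ _ _   | tri≈ _ _ _   = λ ()
... | tri< _ _ _   | tri> _ _ _   = λ ()
... | tri≈ _ v≡w _ | _            = λ _ → v≢w v≡w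
... | tri> _ _ _   | tri< _ _ _   = λ ()
... | tri> _ _ _   | tri≈ _ w≡v _ = λ _ → v≢w (sym w≡v)
... | tri> _ _ w<v | tri> _ _ v<w = λ _ → <-asym v<w w<v

Joins : ∀ {A : Set} → A → A → A × A → Set
Joins y w s = s ≡ (y , w) ⊎ s ≡ (w , y)

Joins-unique : ∀ {A : Set} {y w : A} {s t : A × A} → Joins y w s → Joins y w t →
               s ≡ t ⊎ s ≡ swap t
Joins-unique (inj₁ refl) (inj₁ refl) = inj₁ refl
Joins-unique (inj₁ refl) (inj₂ refl) = inj₂ refl
Joins-unique (inj₂ refl) (inj₁ refl) = inj₂ refl
Joins-unique (inj₂ refl) (inj₂ refl) = inj₁ refl

module _ {n : ℕ} {G : SimpleGraph n} {m : ℕ} (E : EdgeColouring G m) where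
  open SimpleGraph G using (Adj)
  open EdgeColouring E

  edgeColour : Incidence G → Fin m
  edgeColour ((u , v) , p) = col u v p

  record SeenFrom (y : Fin n) (a : Incidence G) : Set where
    field
      far       : Fin n
      adj       : Adj y far ≡ true
      colour≡   : edgeColour a ≡ col y far adj
      endpoints : Joins y far (proj₁ a)

  seenFrom : ∀ y a → InI G y a → SeenFrom y a
  seenFrom y ((u , v) , p) (inj₁ refl) = record
    { far = v ; adj = p ; colour≡ = refl ; endpoints = inj₁ refl }
  seenFrom y ((u , v) , p) (inj₂ refl) = record
    { far = u ; adj = Adj-sym G p ; colour≡ = col-sym u v p (Adj-sym G p) ; endpoints = inj₂ refl }

  col-injective : ∀ {y v w} (p : Adj y v ≡ true) (q : Adj y w ≡ true) →
                  col y v p ≡ col y w q → v ≡ w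
  col-injective {y} {v} {w} p q eq with v ≟ w
  ... | yes v≡w = v≡w
  ... | no  v≢w = contradiction eq (proper y v w p q v≢w)

  sameColour⇒sameEdge : ∀ {a b} → Conflict G a b → edgeColour a ≡ edgeColour b →
                        proj₁ a ≡ proj₁ b ⊎ proj₁ a ≡ swap (proj₁ b)
  sameColour⇒sameEdge {a} {b} (y , ia , ib) eq =
    Joins-unique (endpoints A) (subst (λ w → Joins y w (proj₁ b)) (sym farA≡farB) (endpoints B))
    where
    A : SeenFrom y a
    A = seenFrom y a ia
    B : SeenFrom y b
    B = seenFrom y b ib
    open SeenFrom
    farA≡farB : far A ≡ far B
    farA≡farB = col-injective (adj A) (adj B) (trans (sym (colour≡ A)) (trans eq (colour≡ B)))

  incidenceColour : Incidence G → Fin (2 * m)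
  incidenceColour a@((v , w) , _) = combine (orientation v w) (edgeColour a)

  incidenceColour-conflictFree : ∀ a b → DistinctInc G a b → Conflict G a b →
                                 incidenceColour a ≢ incidenceColour b
  incidenceColour-conflictFree a@((u , v) , p) b@((u' , v') , p') a≢b conflict eq
    with combine-injective (orientation u v) (edgeColour a) (orientation u' v') (edgeColour b) eq
  ... | sameOrientation , sameColour with sameColour⇒sameEdge {a} {b} conflict sameColour
  ... | inj₁ a≡b  = a≢b a≡b
  ... | inj₂ refl = orientation-flip (Adj⇒≢ G p) sameOrientation

  doubledColouring : ConflictFreeIncColouring G (2 * m)
  doubledColouring = record
    { col = incidenceColour ; conflictFree = incidenceColour-conflictFree }

proposition2p2 : (n : ℕ) (G : SimpleGraph n) →
    IsChromaticIndex G (Δ G) → IsCFIncChromatic G (2 * Δ G)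
proposition2p2 n G (E , _) = doubledColouring E , λ _ → 2*Δ≤ G
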